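{- Let $t\ge 3$ be an integer and let $G_t$ be the labeled complete graph on $2t$ vertices in which the edges of a fixed perfect matching $M_t$ (consisting of $t$ pairwise disjoint edges) are labeled $-$ and all other edges are labeled $+$. Consider the linear program $\mathsf{L}$ with variables $x_{uv}$ (one for each unordered pair of distinct vertices) and $M\in\mathbb{R}$: minimize $M$ subject to $x_{uv}\le x_{uz}+x_{zv}$ for all distinct $u,v,z$; $\sum_{w\in N^+(v)}x_{vw}+\sum_{w\in N^-(v)}(1-x_{vw})\le M$ for all vertices $v$; and $0\le x_{e}\le 1$ for all pairs $e$. Then $\mathsf{L}$ has a unique optimal solution, and in it $x_{uv}=0$ for every pair $uv$.
   Context: $N^+(v)$ and $N^-(v)$ denote the sets of vertices joined to $v$ by $+$ edges and by $-$ edges, respectively.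
   Formalization: The variables $x_{uv}$ and $M$ of the linear program take values in ℚ instead of ℝ, so the competing solutions in the optimality and uniqueness claims are rational as well. -}

module Defs where

open import Data.Nat using (ℕ; _*_)
open import Data.Fin using (Fin)
open import Data.Fin.Properties using (_≟_)
open import Data.List using (List; map; foldr)
open import Data.List.Base using (allFin)
open import Data.Rational using (ℚ; 0ℚ; 1ℚ; _+_; _-_; _≤_)
open import Data.Product using (_×_; Σ; _,_)
open import Relation.Nullary using (¬_; yes; no)
open import Relation.Binary.PropositionalEquality using (_≡_)

Vertex : ℕ → Set
Vertex n = Fin n

-- A perfect matching on the vertex set, given as a fixed-point-free
-- involution m (the edge at v is {v, m v}).
IsPerfectMatching : (n : ℕ) → (Vertex n → Vertex n) → Set
IsPerfectMatching n m = (∀ v → m (m v) ≡ v) × (∀ v → ¬ (m v ≡ v))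

-- Assignments of x to unordered pairs: symmetric functions; the
-- diagonal values x v v are meaningless and never used.
Symmetric : (n : ℕ) → (Vertex n → Vertex n → ℚ) → Set
Symmetric n x = ∀ u v → x u v ≡ x v u

sumℚ : List ℚ → ℚ
sumℚ = foldr _+_ 0ℚ

-- Contribution of w to the vertex constraint of v in G_t:
-- w ∈ N^-(v) iff w = m v (the matching edge, labeled -);
-- w ∈ N^+(v) iff w ≠ v and w ≠ m v; w = v contributes nothing.
term : (n : ℕ) → (Vertex n → Vertex n) → (Vertex n → Vertex n → ℚ) →
       Vertex n → Vertex n → ℚ
term n m x v w with w ≟ v
... | yes _ = 0ℚ
... | no _ with w ≟ m v
...   | yes _ = 1ℚ - x v w
...   | no _ = x v w

vertexCost : (n : ℕ) → (Vertex n → Vertex n) → (Vertex n → Vertex n → ℚ) →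
             Vertex n → ℚ
vertexCost n m x v = sumℚ (map (term n m x v) (allFin n))

Feasible : (n : ℕ) → (Vertex n → Vertex n) → (Vertex n → Vertex n → ℚ) → ℚ → Set
Feasible n m x M =
  Symmetric n x ×
  (∀ u v z → ¬ (u ≡ v) → ¬ (v ≡ z) → ¬ (u ≡ z) → x u v ≤ x u z + x z v) ×
  (∀ v → vertexCost n m x v ≤ M) ×
  (∀ u v → ¬ (u ≡ v) → (0ℚ ≤ x u v) × (x u v ≤ 1ℚ))

Optimal : (n : ℕ) → (Vertex n → Vertex n) → (Vertex n → Vertex n → ℚ) → ℚ → Set
Optimal n m x M =
  Feasible n m x M × (∀ x' M' → Feasible n m x' M' → M ≤ M')

{-# OPTIONS --safe #-}
-- The zero assignment with M = 1 is feasible: each vertex pays exactly 1, for its matching edge.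
-- Conversely, let vv' be a matching edge and c = x v v'. Adding the constraints at v and v' and
-- using the triangle inequality c ≤ x v w + x w v' at three further vertices w (here 2t ≥ 5 is
-- needed) gives 2M ≥ 2(1 − c) + 3c = 2 + c. Hence M ≥ 1; at an optimum M = 1, so c = 0, and then
-- the constraint at u reads 1 + x u w ≤ 1 for every other w, forcing x u w = 0.
module Submission where

open import Defs
open import Data.Fin using (Fin; zero; suc; punchIn; punchOut)
open import Data.Fin.Properties using (_≟_; punchInᵢ≢i; punchIn-injective; punchIn-punchOut)
open import Data.List using (tabulate)
open import Data.List.Properties using (map-tabulate)
open import Data.Product using (_×_; Σ; _,_; proj₁; proj₂)
open import Data.Vec.Functional using (replicate)
open import Function using (id; _∘_)
open import Relation.Nullary using (¬_; yes; no; contradiction)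
open import Relation.Binary.PropositionalEquality using (_≡_; _≢_; refl; sym; trans; cong; cong₂; subst)

-- The rational order is in scope only inside this block, so that ℕ's _≤_ can be opened for the theorem.
module _ where
  import Data.Nat as ℕ
  open import Data.Rational using (ℚ; 0ℚ; 1ℚ; _+_; _-_; -_; _≤_)
  open import Data.Rational.Properties
    using (≤-refl; ≤-trans; ≤-reflexive; ≤-antisym; ≮⇒≥; <-irrefl; <-≤-trans; +-mono-≤; +-monoˡ-≤; +-monoʳ-≤; +-monoʳ-<;
           +-mono-<; +-identityˡ; +-identityʳ; +-inverseʳ; nonNegative⁻¹; +-0-commutativeMonoid; module ≤-Reasoning)
  open import Data.Rational.Solver using (module +-*-Solver)
  open import Algebra.Bundles using (CommutativeMonoid)
  open import Algebra.Properties.CommutativeMonoid.Sum +-0-commutativeMonoid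
    using (sum; sum-remove; ∑-distrib-+; sum-cong-≗; sum-replicate-zero)
  open import Algebra.Definitions.RawMonoid (CommutativeMonoid.rawMonoid +-0-commutativeMonoid) using () renaming (_×_ to _·_)
  open +-*-Solver using (solve; _:=_; _:+_; _:-_; con)
  open ≤-Reasoning

  private variable
    n k : ℕ.ℕ
    p q M : ℚ
    m : Vertex n → Vertex n
    x : Vertex n → Vertex n → ℚ

  +-cancelˡ-≤ : ∀ r → r + p ≤ r + q → p ≤ q
  +-cancelˡ-≤ r r+p≤r+q = ≮⇒≥ λ q<p → <-irrefl refl (<-≤-trans (+-monoʳ-< r q<p) r+p≤r+q)

  double-cancel-≤ : p + p ≤ q + q → p ≤ q
  double-cancel-≤ p+p≤q+q = ≮⇒≥ λ q<p → <-irrefl refl (<-≤-trans (+-mono-< q<p q<p) p+p≤q+q)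

  p≤q⇒0≤q-p : p ≤ q → 0ℚ ≤ q - p
  p≤q⇒0≤q-p {p} p≤q = ≤-trans (≤-reflexive (sym (+-inverseʳ p))) (+-monoˡ-≤ (- p) p≤q)

  sumℚ-tabulate : (f : Fin n → ℚ) → sumℚ (tabulate f) ≡ sum f
  sumℚ-tabulate {ℕ.zero}  f = refl
  sumℚ-tabulate {ℕ.suc n} f = cong (f zero +_) (sumℚ-tabulate (f ∘ suc))

  sum-mono-≤ : {f g : Fin n → ℚ} → (∀ i → f i ≤ g i) → sum f ≤ sum g
  sum-mono-≤ {ℕ.zero}  f≤g = ≤-refl
  sum-mono-≤ {ℕ.suc n} f≤g = +-mono-≤ (f≤g zero) (sum-mono-≤ (f≤g ∘ suc))

  sum-nonneg : {f : Fin n → ℚ} → (∀ i → 0ℚ ≤ f i) → 0ℚ ≤ sum f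
  sum-nonneg {n} 0≤f = ≤-trans (≤-reflexive (sym (sum-replicate-zero n))) (sum-mono-≤ 0≤f)

  ·-≤-sum : {f : Fin n → ℚ} {c : ℚ} → 0ℚ ≤ c → k ℕ.≤ n → (∀ i → c ≤ f i) → k · c ≤ sum f
  ·-≤-sum 0≤c ℕ.z≤n       c≤f = sum-nonneg (λ i → ≤-trans 0≤c (c≤f i))
  ·-≤-sum 0≤c (ℕ.s≤s k≤n) c≤f = +-mono-≤ (c≤f zero) (·-≤-sum 0≤c k≤n (c≤f ∘ suc))

  sum-single : {f : Fin n → ℚ} (i : Fin n) → (∀ j → j ≢ i → f j ≡ 0ℚ) → sum f ≡ f i
  sum-single {ℕ.suc n} {f} i f≡0 = begin-equality
    sum f                             ≡⟨ sum-remove f ⟩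
    f i + sum (f ∘ punchIn i)         ≡⟨ cong (f i +_) (sum-cong-≗ (λ j → f≡0 (punchIn i j) (punchInᵢ≢i i j))) ⟩
    f i + sum (replicate n 0ℚ)        ≡⟨ cong (f i +_) (sum-replicate-zero n) ⟩
    f i + 0ℚ                          ≡⟨ +-identityʳ (f i) ⟩
    f i                               ∎

  punchIn₂ : {i j : Fin (ℕ.suc (ℕ.suc n))} → i ≢ j → Fin n → Fin (ℕ.suc (ℕ.suc n))
  punchIn₂ {i = i} i≢j = punchIn i ∘ punchIn (punchOut i≢j)

  punchIn₂≢ˡ : {i j : Fin (ℕ.suc (ℕ.suc n))} (i≢j : i ≢ j) (k : Fin n) → punchIn₂ i≢j k ≢ i
  punchIn₂≢ˡ {i = i} i≢j k = punchInᵢ≢i i _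

  punchIn₂≢ʳ : {i j : Fin (ℕ.suc (ℕ.suc n))} (i≢j : i ≢ j) (k : Fin n) → punchIn₂ i≢j k ≢ j
  punchIn₂≢ʳ {i = i} i≢j k eq = punchInᵢ≢i (punchOut i≢j) k
    (punchIn-injective i _ _ (trans eq (sym (punchIn-punchOut i≢j))))

  sum-remove₂ : (f : Fin (ℕ.suc (ℕ.suc n)) → ℚ) {i j : Fin (ℕ.suc (ℕ.suc n))} (i≢j : i ≢ j) →
                sum f ≡ f i + (f j + sum (f ∘ punchIn₂ i≢j))
  sum-remove₂ f {i} {j} i≢j = begin-equality
    sum f                                                            ≡⟨ sum-remove f ⟩
    f i + sum (f ∘ punchIn i)                                        ≡⟨ cong (f i +_) (sum-remove {i = punchOut i≢j} (f ∘ punchIn i)) ⟩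
    f i + (f (punchIn i (punchOut i≢j)) + sum (f ∘ punchIn₂ i≢j))    ≡⟨ cong (λ w → f i + (f w + sum (f ∘ punchIn₂ i≢j))) (punchIn-punchOut i≢j) ⟩
    f i + (f j + sum (f ∘ punchIn₂ i≢j))                             ∎

  pair-≤-sum : {f : Fin (ℕ.suc (ℕ.suc n)) → ℚ} → (∀ i → 0ℚ ≤ f i) →
               {i j : Fin (ℕ.suc (ℕ.suc n))} → i ≢ j → f i + f j ≤ sum f
  pair-≤-sum {f = f} 0≤f {i} {j} i≢j = begin
    f i + f j                                ≡⟨ cong (f i +_) (+-identityʳ (f j)) ⟨
    f i + (f j + 0ℚ)                         ≤⟨ +-monoʳ-≤ (f i) (+-monoʳ-≤ (f j) (sum-nonneg (0≤f ∘ punchIn₂ i≢j))) ⟩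
    f i + (f j + sum (f ∘ punchIn₂ i≢j))     ≡⟨ sum-remove₂ f i≢j ⟨
    sum f                                    ∎

  term-self : (v : Vertex n) → term n m x v v ≡ 0ℚ
  term-self v with v ≟ v
  ... | yes _   = refl
  ... | no v≢v = contradiction refl v≢v

  term-partner : {v w : Vertex n} → w ≢ v → w ≡ m v → term n m x v w ≡ 1ℚ - x v w
  term-partner {m = m} {v = v} {w} w≢v w≡mv with w ≟ v
  ... | yes w≡v = contradiction w≡v w≢v
  ... | no _ with w ≟ m v
  ...   | yes _    = refl
  ...   | no w≢mv = contradiction w≡mv w≢mv

  term-other : {v w : Vertex n} → w ≢ v → w ≢ m v → term n m x v w ≡ x v w
  term-other {m = m} {v = v} {w} w≢v w≢mv with w ≟ v
  ... | yes w≡v = contradiction w≡v w≢v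
  ... | no _ with w ≟ m v
  ...   | yes w≡mv = contradiction w≡mv w≢mv
  ...   | no _      = refl

  term-nonneg : (∀ u v → u ≢ v → (0ℚ ≤ x u v) × (x u v ≤ 1ℚ)) → ∀ v w → 0ℚ ≤ term n m x v w
  term-nonneg {m = m} bounds v w with w ≟ v
  ... | yes _ = ≤-refl
  ... | no w≢v with w ≟ m v
  ...   | yes _ = p≤q⇒0≤q-p (proj₂ (bounds v w (w≢v ∘ sym)))
  ...   | no _  = proj₁ (bounds v w (w≢v ∘ sym))

  vertexCost≡sum : ∀ v → vertexCost n m x v ≡ sum (term n m x v)
  vertexCost≡sum {n} {m} {x} v = trans (cong sumℚ (map-tabulate id (term n m x v))) (sumℚ-tabulate (term n m x v))

  sum-term≤M : (∀ v → vertexCost n m x v ≤ M) → ∀ v → sum (term n m x v) ≤ M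
  sum-term≤M {M = M} cost≤M v = subst (_≤ M) (vertexCost≡sum v) (cost≤M v)

  pair-cost-lower-bound : IsPerfectMatching n m → 5 ℕ.≤ n → Feasible n m x M →
                          ∀ v → 1ℚ + 1ℚ + x v (m v) ≤ M + M
  pair-cost-lower-bound {m = m} {x = x} {M = M} (involutive , fixpoint-free) (ℕ.s≤s (ℕ.s≤s 3≤n))
                        (symmetric , triangle , cost≤M , bounds) v = begin
    1ℚ + 1ℚ + c                                 ≡⟨ solve 1 (λ c → con 1ℚ :+ con 1ℚ :+ c :=
                                                     (con 1ℚ :- c) :+ ((con 1ℚ :- c) :+ (c :+ (c :+ (c :+ con 0ℚ))))) refl c ⟩
    (1ℚ - c) + ((1ℚ - c) + 3 · c)               ≡⟨ cong₂ (λ a b → a + (b + 3 · c)) f-v f-v' ⟨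
    f v + (f v' + 3 · c)                        ≤⟨ +-monoʳ-≤ (f v) (+-monoʳ-≤ (f v') (·-≤-sum 0≤c 3≤n c≤f-rest)) ⟩
    f v + (f v' + sum (f ∘ punchIn₂ v≢v'))      ≡⟨ sum-remove₂ f v≢v' ⟨
    sum f                                       ≡⟨ ∑-distrib-+ (term _ m x v) (term _ m x v') ⟩
    sum (term _ m x v) + sum (term _ m x v')    ≤⟨ +-mono-≤ (sum-term≤M cost≤M v) (sum-term≤M cost≤M v') ⟩
    M + M                                       ∎
    where
    v' = m v
    c = x v v'
    f : Vertex _ → ℚ
    f w = term _ m x v w + term _ m x v' w

    v≢v' : v ≢ v'
    v≢v' = fixpoint-free v ∘ sym

    0≤c : 0ℚ ≤ c
    0≤c = proj₁ (bounds v v' v≢v')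

    f-v : f v ≡ 1ℚ - c
    f-v = begin-equality
      term _ m x v v + term _ m x v' v   ≡⟨ cong₂ _+_ (term-self v) (term-partner v≢v' (sym (involutive v))) ⟩
      0ℚ + (1ℚ - x v' v)                 ≡⟨ +-identityˡ _ ⟩
      1ℚ - x v' v                        ≡⟨ cong (λ y → 1ℚ - y) (symmetric v' v) ⟩
      1ℚ - c                             ∎

    f-v' : f v' ≡ 1ℚ - c
    f-v' = trans (cong₂ _+_ (term-partner (v≢v' ∘ sym) refl) (term-self v')) (+-identityʳ _)

    c≤f-rest : ∀ k → c ≤ f (punchIn₂ v≢v' k)
    c≤f-rest k = begin
      x v v'               ≤⟨ triangle v v' w v≢v' (w≢v' ∘ sym) (w≢v ∘ sym) ⟩
      x v w + x w v'       ≡⟨ cong₂ _+_ (term-other w≢v w≢v') (trans (term-other w≢v' w≢mv') (symmetric v' w)) ⟨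
      f w                  ∎
      where
      w = punchIn₂ v≢v' k
      w≢v = punchIn₂≢ˡ v≢v' k
      w≢v' = punchIn₂≢ʳ v≢v' k
      w≢mv' : w ≢ m v'
      w≢mv' w≡mv' = w≢v (trans w≡mv' (involutive v))

  feasible⇒1≤M : IsPerfectMatching n m → 5 ℕ.≤ n → Feasible n m x M → 1ℚ ≤ M
  feasible⇒1≤M {m = m} {x = x} {M = M} matching@(_ , fixpoint-free) 5≤n@(ℕ.s≤s _) feasible@(_ , _ , _ , bounds) =
    double-cancel-≤ (begin
      1ℚ + 1ℚ                   ≡⟨ +-identityʳ _ ⟨
      1ℚ + 1ℚ + 0ℚ              ≤⟨ +-monoʳ-≤ (1ℚ + 1ℚ) (proj₁ (bounds zero (m zero) (fixpoint-free zero ∘ sym))) ⟩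
      1ℚ + 1ℚ + x zero (m zero) ≤⟨ pair-cost-lower-bound matching 5≤n feasible zero ⟩
      M + M                     ∎)

  zero-feasible : IsPerfectMatching n m → Feasible n m (λ _ _ → 0ℚ) 1ℚ
  zero-feasible {n} {m} (_ , fixpoint-free) =
    (λ _ _ → refl) , (λ _ _ _ _ _ _ → ≤-refl) , cost≤1 , (λ _ _ _ → ≤-refl , nonNegative⁻¹ 1ℚ)
    where
    term≡0 : ∀ v w → w ≢ m v → term n m (λ _ _ → 0ℚ) v w ≡ 0ℚ
    term≡0 v w w≢mv with w ≟ v
    ... | yes _ = refl
    ... | no _ with w ≟ m v
    ...   | yes w≡mv = contradiction w≡mv w≢mv
    ...   | no _      = refl

    cost≤1 : ∀ v → vertexCost n m (λ _ _ → 0ℚ) v ≤ 1ℚ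
    cost≤1 v = ≤-reflexive (begin-equality
      vertexCost n m (λ _ _ → 0ℚ) v    ≡⟨ vertexCost≡sum v ⟩
      sum (term n m (λ _ _ → 0ℚ) v)   ≡⟨ sum-single (m v) (term≡0 v) ⟩
      term n m (λ _ _ → 0ℚ) v (m v)   ≡⟨ term-partner (fixpoint-free v) refl ⟩
      1ℚ                               ∎)

  zero-optimal : IsPerfectMatching n m → 5 ℕ.≤ n → Optimal n m (λ _ _ → 0ℚ) 1ℚ
  zero-optimal matching 5≤n = zero-feasible matching , λ _ _ → feasible⇒1≤M matching 5≤n

  optimal⇒M≡1 : IsPerfectMatching n m → 5 ℕ.≤ n → Optimal n m x M → M ≡ 1ℚ
  optimal⇒M≡1 matching 5≤n (feasible , minimal) =
    ≤-antisym (minimal _ _ (zero-feasible matching)) (feasible⇒1≤M matching 5≤n feasible)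

  optimal⇒partner≡0 : IsPerfectMatching n m → 5 ℕ.≤ n → Optimal n m x M → ∀ u → x u (m u) ≡ 0ℚ
  optimal⇒partner≡0 {m = m} {x = x} {M = M} matching@(_ , fixpoint-free) 5≤n
                    optimal@(feasible@(_ , _ , _ , bounds) , _) u =
    ≤-antisym (+-cancelˡ-≤ (1ℚ + 1ℚ) (begin
      1ℚ + 1ℚ + x u (m u)  ≤⟨ pair-cost-lower-bound matching 5≤n feasible u ⟩
      M + M                ≡⟨ cong (λ y → y + y) (optimal⇒M≡1 matching 5≤n optimal) ⟩
      1ℚ + 1ℚ              ≡⟨ +-identityʳ _ ⟨
      1ℚ + 1ℚ + 0ℚ         ∎))
      (proj₁ (bounds u (m u) (fixpoint-free u ∘ sym)))

  optimal⇒x≡0 : IsPerfectMatching n m → 5 ℕ.≤ n → Optimal n m x M → ∀ u v → u ≢ v → x u v ≡ 0ℚ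
  optimal⇒x≡0 {m = m} {x = x} {M = M} matching@(_ , fixpoint-free) 5≤n@(ℕ.s≤s (ℕ.s≤s _))
              optimal@((_ , _ , cost≤M , bounds) , _) u v u≢v with v ≟ m u
  ... | yes refl = optimal⇒partner≡0 matching 5≤n optimal u
  ... | no v≢mu  = ≤-antisym (+-cancelˡ-≤ 1ℚ (begin
      1ℚ + x u v                          ≡⟨ cong₂ _+_ term-partner≡1 (term-other (u≢v ∘ sym) v≢mu) ⟨
      term _ m x u (m u) + term _ m x u v ≤⟨ pair-≤-sum (term-nonneg bounds u) (v≢mu ∘ sym) ⟩
      sum (term _ m x u)                  ≤⟨ sum-term≤M cost≤M u ⟩
      M                                   ≡⟨ optimal⇒M≡1 matching 5≤n optimal ⟩
      1ℚ                                  ≡⟨ +-identityʳ 1ℚ ⟨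
      1ℚ + 0ℚ                             ∎))
      (proj₁ (bounds u v u≢v))
    where
    term-partner≡1 : term _ m x u (m u) ≡ 1ℚ
    term-partner≡1 = trans (term-partner (fixpoint-free u) refl)
                           (cong (λ y → 1ℚ - y) (optimal⇒partner≡0 matching 5≤n optimal u))

open import Data.Nat using (ℕ; _≤_; _*_)
open import Data.Nat.Properties using (*-monoʳ-≤; <⇒≤)
open import Data.Rational using (ℚ; 0ℚ; 1ℚ)

proposition1 : (t : ℕ) → 3 ≤ t →
    (m : Fin (2 * t) → Fin (2 * t)) → IsPerfectMatching (2 * t) m →
    Σ (Fin (2 * t) → Fin (2 * t) → ℚ) λ x → Σ ℚ λ M →
      Optimal (2 * t) m x M ×
      (∀ x' M' → Optimal (2 * t) m x' M' →
         (∀ u v → ¬ (u ≡ v) → x' u v ≡ x u v) × (M' ≡ M)) ×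
      (∀ u v → ¬ (u ≡ v) → x u v ≡ 0ℚ)
proposition1 t 3≤t m matching =
  (λ _ _ → 0ℚ) , 1ℚ , zero-optimal matching 5≤2t ,
  (λ _ _ optimal → optimal⇒x≡0 matching 5≤2t optimal , optimal⇒M≡1 matching 5≤2t optimal) ,
  (λ _ _ _ → refl)
  where
  5≤2t : 5 ≤ 2 * t
  5≤2t = <⇒≤ (*-monoʳ-≤ 2 3≤t)
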